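{- Let $x:[t]\to\mathbb{Z}\setminus\{0\}$ be such that $(x(1),\ldots,x(t))$ is generalized Catalan, and let $\pi\in\mathfrak{S}_t$ be the permutation associated to $x$. Let $1\le i<j\le t$. (I) If $x(i),x(j)>0$ then $\pi^{ -1}(i)<\pi^{ -1}(j)$. (II) If $x(i),x(j)<0$ then $\pi^{ -1}(i)<\pi^{ -1}(j)$. (III) If $x(i)<0$ and $x(j)>0$ then $\pi^{ -1}(i)<\pi^{ -1}(j)$.
   Context: A list $(x_1,\ldots,x_t)$ of nonzero integers is generalized Catalan if $\sum_{i=1}^t x_i=0$ and $\sum_{i=1}^q x_i\ge0$ for all $1\le q\le t$. $[t]=\{1,\ldots,t\}$. The permutation $\pi$ associated to $x$: $\pi(1)=1$; for $2\le q\le t$, let $s=\min\{i\in[t]: i\notin\{\pi(1),\ldots,\pi(q-1)\},\ x(i)<0\}$ and $s'=\min\{i\in[t]: i\notin\{\pi(1),\ldots,\pi(q-1)\},\ x(i)>0\}$ (minimum of the empty set is $\infty$); then $\pi(q)=s$ if $s<\infty$ and $\sum_{i=1}^{q-1}x(\pi(i))+x(s)\ge0$, and $\pi(q)=s'$ otherwise. (This construction always yields a permutation of $[t]$.) -}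

module Defs where

open import Data.Nat using (ℕ; zero; suc)
open import Data.Fin using (Fin; zero; suc; _≟_)
open import Data.List using (List; []; _∷_; _++_; [_]; filter; map; take; foldr; length; lookup; allFin)
open import Data.Maybe using (Maybe; just; nothing)
open import Data.Integer using (ℤ; _+_; _<_; _≤_; _<?_; _≤?_; 0ℤ)
open import Data.Product using (Σ; _×_; _,_)
open import Relation.Nullary using (¬_; yes; no)
open import Relation.Nullary.Decidable using (¬?; _×-dec_)
open import Relation.Binary.PropositionalEquality using (_≡_; _≢_)
import Data.List.Membership.DecPropositional as MemDec
import Data.Fin as F

-- Indices are 0-based: index k : Fin t stands for k+1 ∈ [t].

sumℤ : List ℤ → ℤ
sumℤ = foldr _+_ 0ℤ

prefixSum : {t : ℕ} → (Fin t → ℤ) → ℕ → ℤ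
prefixSum {t} x q = sumℤ (map x (take q (allFin t)))

GenCatalan : (t : ℕ) → (Fin t → ℤ) → Set
GenCatalan t x =
  ((i : Fin t) → x i ≢ 0ℤ) ×
  (prefixSum x t ≡ 0ℤ) ×
  ((q : ℕ) → 1 Data.Nat.≤ q → q Data.Nat.≤ t → 0ℤ ≤ prefixSum x q)

head? : {A : Set} → List A → Maybe A
head? [] = nothing
head? (a ∷ _) = just a

firstNeg : {t : ℕ} → (Fin t → ℤ) → List (Fin t) → Maybe (Fin t)
firstNeg {t} x used = let open MemDec (_≟_ {t}) in head? (filter (λ i → ¬? (i ∈? used) ×-dec (x i <? 0ℤ)) (allFin t))

firstPos : {t : ℕ} → (Fin t → ℤ) → List (Fin t) → Maybe (Fin t)
firstPos {t} x used = let open MemDec (_≟_ {t}) in head? (filter (λ i → ¬? (i ∈? used) ×-dec (0ℤ <? x i)) (allFin t))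

-- next value π(q), given used = [π(1),...,π(q-1)] and S = Σ_{i<q} x(π(i))
nextIndex : {t : ℕ} → (Fin t → ℤ) → List (Fin t) → ℤ → Maybe (Fin t)
nextIndex x used S with firstNeg x used
... | nothing = firstPos x used
... | just s with 0ℤ ≤? (S + x s)
...   | yes _ = just s
...   | no _ = firstPos x used

buildπ : {t : ℕ} → (Fin t → ℤ) → ℕ → List (Fin t) → ℤ → List (Fin t)
buildπ x zero used S = []
buildπ x (suc k) used S with nextIndex x used S
... | nothing = []
... | just s = s ∷ buildπ x k (used ++ [ s ]) (S + x s)

-- the permutation associated to x, as the list (π(1),...,π(t))
assocπ : (t : ℕ) → (Fin t → ℤ) → List (Fin t)
assocπ zero x = []
assocπ (suc n) x = zero ∷ buildπ x n [ zero ] (x zero)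

-- π⁻¹(i) < π⁻¹(j): i occurs in the list π strictly before j
PrecedesIn : {t : ℕ} → List (Fin t) → Fin t → Fin t → Set
PrecedesIn π i j =
  Σ (Fin (length π)) λ p → Σ (Fin (length π)) λ q →
    (p F.< q) × (lookup π p ≡ i) × (lookup π q ≡ j)

module Submission where

-- Read the construction of π as a run whose state is the list `used` of indices placed so far
-- together with the running sum S of their values.  Negative indices are placed in increasing
-- order, and so are positive ones; this gives (I) and (II).  For (III), suppose the positive j is
-- placed while the negative i < j is not.  Then the least unused negative s ≤ i was rejected, so
-- S + x(s) < 0.  But every positive index below s lies below j and is already used, and no used
-- negative lies above s; so S + x(s) dominates the prefix sum x(1) + ⋯ + x(s), which is ≥ 0 by the
-- Catalan condition.  The same bound shows that the run never stops while an index is unused.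

open import Defs
open import Data.Nat.Base as ℕ using (ℕ; zero; suc; z≤n; s≤s)
import Data.Nat.Properties as ℕ
open import Data.Fin.Base as Fin using (Fin; zero; suc; toℕ; _<_)
import Data.Fin.Properties as Fin
open import Data.Integer.Base using (ℤ; 0ℤ; +_; _+_; +≤+) renaming (_<_ to _<ℤ_; _≤_ to _≤ℤ_)
import Data.Integer.Properties as ℤ
open import Algebra.Properties.Monoid.Sum ℤ.+-0-monoid using (sum; sum-cong-≗; sum-replicate-zero)
open import Algebra.Properties.CommutativeSemigroup ℤ.+-commutativeSemigroup using (xy∙z≈xz∙y)
open import Data.Bool.Base using (if_then_else_)
open import Data.List.Base using (List; []; _∷_; _++_; [_]; filter; map; take; allFin; tabulate)
open import Data.List.Properties using (++-assoc)
open import Data.List.Relation.Unary.Any using (here; there; index)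
open import Data.List.Relation.Unary.Any.Properties using (lookup-index)
open import Data.List.Membership.Propositional.Properties using (∈-++⁺ˡ; ∈-++⁺ʳ; ∈-++⁻)
open import Data.Maybe.Base using (just; nothing)
open import Data.Maybe.Properties using (just-injective)
open import Data.Product.Base using (∃-syntax; _×_; _,_; proj₁; proj₂)
open import Data.Sum.Base using (_⊎_; inj₁; inj₂)
open import Data.Empty using (⊥-elim)
open import Function.Base using (_∘_)
open import Level using (0ℓ)
open import Relation.Binary.Definitions using (tri<; tri≈; tri>)
open import Relation.Binary.PropositionalEquality
  using (_≡_; _≢_; refl; sym; trans; cong; cong₂; subst; module ≡-Reasoning)
open import Relation.Nullary using (¬_; yes; no; does)
open import Relation.Unary using (Pred; Decidable)
open import Relation.Unary.Properties using (U?)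

sum-mono-≤ : ∀ {n} {f g : Fin n → ℤ} → (∀ k → f k ≤ℤ g k) → sum f ≤ℤ sum g
sum-mono-≤ {zero}  f≤g = ℤ.≤-refl
sum-mono-≤ {suc n} f≤g = ℤ.+-mono-≤ (f≤g zero) (sum-mono-≤ (f≤g ∘ suc))

sum-ones : ∀ n → sum {n} (λ _ → + 1) ≡ + n
sum-ones zero    = refl
sum-ones (suc n) = cong (_+_ (+ 1)) (sum-ones n)

sum-update : ∀ {n} (f g : Fin n → ℤ) (s : Fin n) (c : ℤ) →
             (∀ k → k ≢ s → g k ≡ f k) → g s ≡ f s + c → sum g ≡ sum f + c
sum-update {suc n} f g zero c g≗f gs = begin
  g zero + sum (g ∘ suc)      ≡⟨ cong₂ _+_ gs (sum-cong-≗ (λ k → g≗f (suc k) λ ())) ⟩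
  f zero + c + sum (f ∘ suc)  ≡⟨ xy∙z≈xz∙y (f zero) c _ ⟩
  sum f + c                   ∎
  where open ≡-Reasoning
sum-update {suc n} f g (suc s) c g≗f gs = begin
  g zero + sum (g ∘ suc)        ≡⟨ cong₂ _+_ (g≗f zero λ ()) (sum-update (f ∘ suc) (g ∘ suc) s c g≗f′ gs) ⟩
  f zero + (sum (f ∘ suc) + c)  ≡⟨ ℤ.+-assoc (f zero) _ c ⟨
  sum f + c                     ∎
  where
  open ≡-Reasoning
  g≗f′ : ∀ k → k ≢ s → g (suc k) ≡ f (suc k)
  g≗f′ k k≢s = g≗f (suc k) (k≢s ∘ Fin.suc-injective)

restrict : ∀ {n p} {P : Pred (Fin n) p} → Decidable P → (Fin n → ℤ) → Fin n → ℤ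
restrict P? f k = if does (P? k) then f k else 0ℤ

sum-restrict-≤ : ∀ {n p q} {P : Pred (Fin n) p} {Q : Pred (Fin n) q}
                 (P? : Decidable P) (Q? : Decidable Q) {f : Fin n → ℤ} →
                 (∀ k → P k → ¬ Q k → f k ≤ℤ 0ℤ) → (∀ k → ¬ P k → Q k → 0ℤ ≤ℤ f k) →
                 sum (restrict P? f) ≤ℤ sum (restrict Q? f)
sum-restrict-≤ P? Q? {f} dropped added = sum-mono-≤ pointwise
  where
  pointwise : ∀ k → restrict P? f k ≤ℤ restrict Q? f k
  pointwise k with P? k | Q? k
  ... | yes _  | yes _  = ℤ.≤-refl
  ... | yes p  | no ¬q  = dropped k p ¬q
  ... | no ¬p  | yes q  = added k ¬p q
  ... | no _   | no _   = ℤ.≤-refl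

sum-take-tabulate : ∀ {m n} (x : Fin n → ℤ) (f : Fin m → Fin n) q →
                    sumℤ (map x (take q (tabulate f))) ≡ sum (restrict (λ k → toℕ k ℕ.<? q) (x ∘ f))
sum-take-tabulate {zero}  x f zero    = refl
sum-take-tabulate {zero}  x f (suc q) = refl
sum-take-tabulate {suc m} x f zero    = sym (sum-replicate-zero (suc m))
sum-take-tabulate {suc m} x f (suc q) = cong (_+_ (x (f zero))) (sum-take-tabulate x (f ∘ suc) q)

Minimal : ∀ {n p} → Pred (Fin n) p → Fin n → Set p
Minimal P s = P s × (∀ {k} → k < s → ¬ P k)

module _ {n p} {P : Pred (Fin n) p} (P? : Decidable P) where

  head-filter-tabulate : ∀ {m} (f : Fin m → Fin n) {s} → head? (filter P? (tabulate f)) ≡ just s →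
                         ∃[ q ] f q ≡ s × Minimal (P ∘ f) q
  head-filter-tabulate {suc m} f eq with P? (f zero)
  ... | yes p with just-injective eq
  ...   | refl = zero , refl , p , λ ()
  head-filter-tabulate {suc m} f eq | no ¬p with head-filter-tabulate (f ∘ suc) eq
  ...   | q , fq≡s , p , below = suc q , fq≡s , p , λ { {zero} _ → ¬p ; {suc k} k<q → below (ℕ.s<s⁻¹ k<q) }

  head-filter-tabulate-nothing : ∀ {m} (f : Fin m → Fin n) → head? (filter P? (tabulate f)) ≡ nothing →
                                 ∀ q → ¬ P (f q)
  head-filter-tabulate-nothing {suc m} f eq q with P? (f zero)
  head-filter-tabulate-nothing {suc m} f () q       | yes _
  head-filter-tabulate-nothing {suc m} f eq zero    | no ¬p = ¬p
  head-filter-tabulate-nothing {suc m} f eq (suc q) | no ¬p = head-filter-tabulate-nothing (f ∘ suc) eq q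

  head-filter-allFin : ∀ {s} → head? (filter P? (allFin n)) ≡ just s → Minimal P s
  head-filter-allFin eq with head-filter-tabulate (λ k → k) eq
  ... | _ , refl , minimal = minimal

  head-filter-allFin-nothing : head? (filter P? (allFin n)) ≡ nothing → ∀ k → ¬ P k
  head-filter-allFin-nothing = head-filter-tabulate-nothing (λ k → k)

module _ {n} {i j : Fin n} where
  open import Data.List.Membership.Propositional using (_∈_)

  precedesIn-∷ : ∀ {a L} → PrecedesIn L i j → PrecedesIn (a ∷ L) i j
  precedesIn-∷ (p , q , p<q , Lp≡i , Lq≡j) = suc p , suc q , ℕ.s<s p<q , Lp≡i , Lq≡j

  precedesIn-++-∷ : ∀ L₁ {L₂} → i ∈ L₁ → PrecedesIn (L₁ ++ j ∷ L₂) i j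
  precedesIn-++-∷ (_ ∷ L₁) {L₂} (here refl) = zero , suc (index j∈) , ℕ.z<s , refl , sym (lookup-index j∈)
    where
    j∈ : j ∈ L₁ ++ j ∷ L₂
    j∈ = ∈-++⁺ʳ L₁ (here refl)
  precedesIn-++-∷ (_ ∷ L₁) (there i∈) = precedesIn-∷ (precedesIn-++-∷ L₁ i∈)

module Run {t : ℕ} (x : Fin t → ℤ) where
  open import Data.List.Membership.DecPropositional (Fin._≟_ {t}) using (_∈_; _∉_; _∈?_)

  UnusedNeg UnusedPos : List (Fin t) → Pred (Fin t) 0ℓ
  UnusedNeg used k = k ∉ used × x k <ℤ 0ℤ
  UnusedPos used k = k ∉ used × 0ℤ <ℤ x k

  NegBlocked : List (Fin t) → ℤ → Set
  NegBlocked used S = (∀ k → ¬ UnusedNeg used k) ⊎ (∃[ s ] Minimal (UnusedNeg used) s × S + x s <ℤ 0ℤ)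

  data Choice (used : List (Fin t)) (S : ℤ) (s : Fin t) : Set where
    negative : Minimal (UnusedNeg used) s → Choice used S s
    positive : Minimal (UnusedPos used) s → NegBlocked used S → Choice used S s

  nextIndex-just : ∀ {used S s} → nextIndex x used S ≡ just s → Choice used S s
  nextIndex-just {used} {S} eq with firstNeg x used in neg
  ... | nothing = positive (head-filter-allFin _ eq) (inj₁ (head-filter-allFin-nothing _ neg))
  ... | just s′ with 0ℤ ℤ.≤? S + x s′
  ...   | yes _ with refl ← eq = negative (head-filter-allFin _ neg)
  ...   | no  ≰ = positive (head-filter-allFin _ eq) (inj₂ (s′ , head-filter-allFin _ neg , ℤ.≰⇒> ≰))

  nextIndex-nothing : ∀ {used S} → nextIndex x used S ≡ nothing → NegBlocked used S × (∀ k → ¬ UnusedPos used k)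
  nextIndex-nothing {used} {S} eq with firstNeg x used in neg
  ... | nothing = inj₁ (head-filter-allFin-nothing _ neg) , head-filter-allFin-nothing _ eq
  ... | just s′ with 0ℤ ℤ.≤? S + x s′
  ...   | yes _ with () ← eq
  ...   | no ≰ = inj₂ (s′ , head-filter-allFin _ neg , ℤ.≰⇒> ≰) , head-filter-allFin-nothing _ eq

  ∈-∷ʳ⁻ : ∀ {k used s} → k ∈ used ++ [ s ] → k ≢ s → k ∈ used
  ∈-∷ʳ⁻ {used = used} k∈ k≢s with ∈-++⁻ used k∈
  ... | inj₁ k∈used      = k∈used
  ... | inj₂ (here refl) = ⊥-elim (k≢s refl)

  ∉-∷ʳ⁻ : ∀ {k used s} → k ∉ used ++ [ s ] → k ∉ used × k ≢ s
  ∉-∷ʳ⁻ {used = used} k∉ = k∉ ∘ ∈-++⁺ˡ , λ { refl → k∉ (∈-++⁺ʳ used (here refl)) }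

  sum-restrict-∷ʳ : ∀ {used s} → s ∉ used → (f : Fin t → ℤ) →
                    sum (restrict (_∈? used ++ [ s ]) f) ≡ sum (restrict (_∈? used) f) + f s
  sum-restrict-∷ʳ {used} {s} s∉ f = sum-update _ _ s (f s) unchanged added
    where
    unchanged : ∀ k → k ≢ s → restrict (_∈? used ++ [ s ]) f k ≡ restrict (_∈? used) f k
    unchanged k k≢s with k ∈? used ++ [ s ] | k ∈? used
    ... | yes _   | yes _     = refl
    ... | yes k∈′ | no k∉     = ⊥-elim (k∉ (∈-∷ʳ⁻ k∈′ k≢s))
    ... | no k∉′  | yes k∈    = ⊥-elim (k∉′ (∈-++⁺ˡ k∈))
    ... | no _    | no _      = refl
    added : restrict (_∈? used ++ [ s ]) f s ≡ restrict (_∈? used) f s + f s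
    added with s ∈? used ++ [ s ] | s ∈? used
    ... | _       | yes s∈ = ⊥-elim (s∉ s∈)
    ... | yes _   | no _   = sym (ℤ.+-identityˡ (f s))
    ... | no s∉′  | no _   = ⊥-elim (s∉′ (∈-++⁺ʳ used (here refl)))

  mass size : List (Fin t) → ℤ
  mass used = sum (restrict (_∈? used) x)
  size used = sum (restrict (_∈? used) (λ _ → + 1))

  size-≤ : ∀ used → size used ≤ℤ + t
  size-≤ used = subst (size used ≤ℤ_) (sum-ones t)
    (sum-restrict-≤ (_∈? used) U? (λ _ _ ¬⊤ → ⊥-elim (¬⊤ _)) (λ _ _ _ → +≤+ z≤n))

  NegClosed : List (Fin t) → Set
  NegClosed used = ∀ {a b} → a < b → x a <ℤ 0ℤ → x b <ℤ 0ℤ → b ∈ used → a ∈ used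

  record Invariant (used : List (Fin t)) (S : ℤ) (fuel : ℕ) : Set where
    field
      running-sum : S ≡ mass used
      fuel-count  : size used + + fuel ≡ + t
      neg-closed  : NegClosed used

  choice-unused : ∀ {used S s} → Choice used S s → s ∉ used
  choice-unused (negative ((s∉ , _) , _))   = s∉
  choice-unused (positive ((s∉ , _) , _) _) = s∉

  neg-closed-step : ∀ {used S s} → Choice used S s → NegClosed used → NegClosed (used ++ [ s ])
  neg-closed-step {used} choice closed {a} a<b xa<0 xb<0 b∈ with ∈-++⁻ used b∈ | a ∈? used
  ... | inj₁ b∈used      | _          = ∈-++⁺ˡ (closed a<b xa<0 xb<0 b∈used)
  ... | inj₂ _           | yes a∈used = ∈-++⁺ˡ a∈used
  ... | inj₂ (here refl) | no a∉ with choice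
  ...   | negative (_ , below)        = ⊥-elim (below a<b (a∉ , xa<0))
  ...   | positive ((_ , 0<xb) , _) _ = ⊥-elim (ℤ.<-asym xb<0 0<xb)

  invariant-step : ∀ {used S s fuel} → Invariant used S (suc fuel) → Choice used S s →
                   Invariant (used ++ [ s ]) (S + x s) fuel
  invariant-step {used} {S} {s} {fuel} inv choice = record
    { running-sum = begin
        S + x s               ≡⟨ cong (_+ x s) running-sum ⟩
        mass used + x s       ≡⟨ sum-restrict-∷ʳ s∉ x ⟨
        mass (used ++ [ s ])  ∎
    ; fuel-count = begin
        size (used ++ [ s ]) + + fuel  ≡⟨ cong (_+ + fuel) (sum-restrict-∷ʳ s∉ _) ⟩
        size used + + 1 + + fuel       ≡⟨ ℤ.+-assoc (size used) (+ 1) (+ fuel) ⟩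
        size used + + suc fuel         ≡⟨ fuel-count ⟩
        + t                            ∎
    ; neg-closed = neg-closed-step choice neg-closed
    }
    where
    open Invariant inv
    open ≡-Reasoning
    s∉ : s ∉ used
    s∉ = choice-unused choice

  fuel-exhausted⇒used : ∀ {used S} → Invariant used S 0 → ∀ j → j ∈ used
  fuel-exhausted⇒used {used} inv j with j ∈? used
  ... | yes j∈ = j∈
  ... | no  j∉ = ⊥-elim (ℕ.m+1+n≰m t (ℤ.drop‿+≤+ t+1≤t))
    where
    open Invariant inv
    open ℤ.≤-Reasoning
    t+1≤t : + t + + 1 ≤ℤ + t
    t+1≤t = begin
      + t + + 1             ≡⟨ cong (_+ + 1) (trans (sym (ℤ.+-identityʳ (size used))) fuel-count) ⟨
      size used + + 1       ≡⟨ sum-restrict-∷ʳ j∉ _ ⟨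
      size (used ++ [ j ])  ≤⟨ size-≤ (used ++ [ j ]) ⟩
      + t                   ∎

  prefixSum-≤-mass : ∀ q used → (∀ k → toℕ k ℕ.< q → k ∉ used → x k ≤ℤ 0ℤ) →
                     (∀ k → q ℕ.≤ toℕ k → k ∈ used → 0ℤ ≤ℤ x k) → prefixSum x q ≤ℤ mass used
  prefixSum-≤-mass q used dropped added = subst (_≤ℤ mass used) (sym (sum-take-tabulate x (λ k → k) q))
    (sum-restrict-≤ (λ k → toℕ k ℕ.<? q) (_∈? used) dropped (λ k k≮q → added k (ℕ.≮⇒≥ k≮q)))

  data SignsForceOrder (i j : Fin t) : Set where
    pos-pos : 0ℤ <ℤ x i → 0ℤ <ℤ x j → SignsForceOrder i j
    neg-neg : x i <ℤ 0ℤ → x j <ℤ 0ℤ → SignsForceOrder i j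
    neg-pos : x i <ℤ 0ℤ → 0ℤ <ℤ x j → SignsForceOrder i j

  module _ (catalan : GenCatalan t x) where

    least-neg-fits : ∀ {used S s fuel} → Invariant used S fuel → Minimal (UnusedNeg used) s →
                     (∀ {k} → k < s → ¬ UnusedPos used k) → 0ℤ ≤ℤ S + x s
    least-neg-fits {used} {S} {s} inv ((s∉ , xs<0) , _) no-pos-below = begin
      0ℤ                         ≤⟨ proj₂ (proj₂ catalan) (suc (toℕ s)) (s≤s z≤n) (Fin.toℕ<n s) ⟩
      prefixSum x (suc (toℕ s))  ≤⟨ prefixSum-≤-mass _ _ dropped added ⟩
      mass (used ++ [ s ])       ≡⟨ sum-restrict-∷ʳ s∉ x ⟩
      mass used + x s            ≡⟨ cong (_+ x s) running-sum ⟨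
      S + x s                    ∎
      where
      open Invariant inv
      open ℤ.≤-Reasoning
      dropped : ∀ k → toℕ k ℕ.< suc (toℕ s) → k ∉ used ++ [ s ] → x k ≤ℤ 0ℤ
      dropped k k≤s k∉ with ∉-∷ʳ⁻ k∉
      ... | k∉used , k≢s = ℤ.≮⇒≥ λ 0<xk →
        no-pos-below (Fin.≤∧≢⇒< (ℕ.s≤s⁻¹ k≤s) k≢s) (k∉used , 0<xk)
      added : ∀ k → suc (toℕ s) ℕ.≤ toℕ k → k ∈ used ++ [ s ] → 0ℤ ≤ℤ x k
      added k s<k k∈ = ℤ.≮⇒≥ λ xk<0 →
        s∉ (neg-closed s<k xs<0 xk<0 (∈-∷ʳ⁻ k∈ (Fin.<⇒≢ s<k ∘ sym)))

    nextIndex-≢nothing : ∀ {used S fuel j} → Invariant used S fuel → j ∉ used → nextIndex x used S ≢ nothing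
    nextIndex-≢nothing {j = j} inv j∉ eq with nextIndex-nothing eq
    ... | inj₂ (s , least , overshoot) , no-pos =
      ℤ.<⇒≱ overshoot (least-neg-fits inv least λ {k} _ → no-pos k)
    ... | inj₁ no-neg , no-pos with ℤ.<-cmp (x j) 0ℤ
    ...   | tri< xj<0 _ _ = no-neg j (j∉ , xj<0)
    ...   | tri≈ _ xj≡0 _ = proj₁ catalan j xj≡0
    ...   | tri> _ _ 0<xj = no-pos j (j∉ , 0<xj)

    placed-before : ∀ {i j used S fuel} → i < j → SignsForceOrder i j → Invariant used S fuel →
                    nextIndex x used S ≡ just j → i ∈ used
    placed-before {i} {j} {used} i<j signs inv eq with i ∈? used | nextIndex-just eq | signs
    ... | yes i∈ | _                              | _              = i∈
    ... | no i∉  | negative (_ , below)           | neg-neg xi<0 _ = ⊥-elim (below i<j (i∉ , xi<0))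
    ... | no _   | negative ((_ , xj<0) , _)      | pos-pos _ 0<xj = ⊥-elim (ℤ.<-asym xj<0 0<xj)
    ... | no _   | negative ((_ , xj<0) , _)      | neg-pos _ 0<xj = ⊥-elim (ℤ.<-asym xj<0 0<xj)
    ... | no i∉  | positive (_ , below) _         | pos-pos 0<xi _ = ⊥-elim (below i<j (i∉ , 0<xi))
    ... | no _   | positive ((_ , 0<xj) , _) _    | neg-neg _ xj<0 = ⊥-elim (ℤ.<-asym xj<0 0<xj)
    ... | no i∉  | positive _ (inj₁ no-neg)       | neg-pos xi<0 _ = ⊥-elim (no-neg i (i∉ , xi<0))
    ... | no i∉  | positive (_ , below-j) (inj₂ (s , least@(_ , below-s) , overshoot)) | neg-pos xi<0 _ =
      ⊥-elim (ℤ.<⇒≱ overshoot (least-neg-fits inv least no-pos-below))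
      where
      s≤i : s Fin.≤ i
      s≤i = ℕ.≮⇒≥ λ i<s → below-s i<s (i∉ , xi<0)
      no-pos-below : ∀ {k} → k < s → ¬ UnusedPos used k
      no-pos-below k<s = below-j (ℕ.<-trans (ℕ.<-≤-trans k<s s≤i) i<j)

    precedes-in-run : ∀ {i j used S fuel} → i < j → SignsForceOrder i j → Invariant used S fuel → j ∉ used →
                      PrecedesIn (used ++ buildπ x fuel used S) i j
    precedes-in-run {fuel = zero} _ _ inv j∉ = ⊥-elim (j∉ (fuel-exhausted⇒used inv _))
    precedes-in-run {i} {j} {used} {S} {suc fuel} i<j signs inv j∉ with nextIndex x used S in eq
    ... | nothing = ⊥-elim (nextIndex-≢nothing inv j∉ eq)
    ... | just s with s Fin.≟ j
    ...   | yes refl = precedesIn-++-∷ used (placed-before i<j signs inv eq)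
    ...   | no s≢j = subst (λ L → PrecedesIn L i j) (++-assoc used [ s ] _)
                       (precedes-in-run i<j signs (invariant-step inv (nextIndex-just eq)) j∉′)
      where
      j∉′ : j ∉ used ++ [ s ]
      j∉′ j∈ = j∉ (∈-∷ʳ⁻ j∈ (s≢j ∘ sym))

invariant-start : ∀ {n} (x : Fin (suc n) → ℤ) → Run.Invariant x [ zero ] (x zero) n
invariant-start {n} x = record
  { running-sum = begin
      x zero                       ≡⟨ ℤ.+-identityˡ (x zero) ⟨
      0ℤ + x zero                  ≡⟨ cong (_+ x zero) (sum-replicate-zero (suc n)) ⟨
      mass [] + x zero             ≡⟨ sum-restrict-∷ʳ {[]} {zero} (λ ()) x ⟨
      mass [ zero ]                ∎
  ; fuel-count = begin
      size [ zero ] + + n          ≡⟨ cong (_+ + n) (sum-restrict-∷ʳ {[]} {zero} (λ ()) (λ _ → + 1)) ⟩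
      size [] + + 1 + + n          ≡⟨ cong (λ z → z + + 1 + + n) (sum-replicate-zero (suc n)) ⟩
      + suc n                      ∎
  ; neg-closed = λ { a<b _ _ (here refl) → ⊥-elim (ℕ.n≮0 a<b) }
  }
  where
  open Run x
  open ≡-Reasoning

lemma2p4 : (t : ℕ) (x : Fin t → ℤ) → GenCatalan t x →
    (i j : Fin t) → i < j →
      ((0ℤ <ℤ x i → 0ℤ <ℤ x j → PrecedesIn (assocπ t x) i j) ×
       (x i <ℤ 0ℤ → x j <ℤ 0ℤ → PrecedesIn (assocπ t x) i j) ×
       (x i <ℤ 0ℤ → 0ℤ <ℤ x j → PrecedesIn (assocπ t x) i j))
lemma2p4 (suc n) x catalan i j i<j =
  (λ xi xj → precedes (pos-pos xi xj)) ,
  (λ xi xj → precedes (neg-neg xi xj)) ,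
  (λ xi xj → precedes (neg-pos xi xj))
  where
  open Run x
  precedes : SignsForceOrder i j → PrecedesIn (assocπ (suc n) x) i j
  precedes signs = precedes-in-run catalan i<j signs (invariant-start x) λ { (here refl) → ℕ.n≮0 i<j }
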